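{- Let $n,\Delta\in\mathbb{N}$ be such that $n\ge\Delta>10\sqrt n$. There exist integer partitions $\mathbf{p}_1,\dots,\mathbf{p}_T\in\mathcal{I}_{\le n}$ such that $\|\mathbf{p}_i-\mathbf{p}_j\|_1\in[0.01\Delta,\Delta]$ for all $i\ne j$ and $T=\exp\left(\Omega\left(\frac{n}{\Delta}\log\left(\frac{\Delta}{\sqrt n}\right)\right)\right)$, where the constant in the $\Omega$ is absolute (independent of $n$ and $\Delta$).
   Context: $\log$ denotes logarithm base 2. An integer partition is an infinite sequence $\mathbf{p}=(p_1,p_2,\dots)$ of non-negative integers with $p_1\ge p_2\ge\cdots$ and finite size $\sum_ip_i$; $\mathcal{I}_{\le n}$ is the set of integer partitions of size at most $n$. $\|\cdot\|_1$ is the $\ell_1$ norm (sequences padded with zeros). -}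

module Defs where

open import Data.Nat using (ℕ; _≤_; ∣_-_∣)
open import Data.Fin as Fin using (Fin)
open import Data.Vec using (Vec; lookup; zipWith; sum)
open import Data.Product using (_×_)

-- An integer partition of size at most n has at most n nonzero parts, so it is
-- faithfully represented by its first n entries (the rest are zero): a
-- non-increasing vector of naturals of length n.
NonIncreasing : {n : ℕ} → Vec ℕ n → Set
NonIncreasing {n} v = (i j : Fin n) → i Fin.≤ j → lookup v j ≤ lookup v i

IsPartitionLe : (n : ℕ) → Vec ℕ n → Set
IsPartitionLe n v = NonIncreasing v × sum v ≤ n

-- ℓ1 distance (sequences padded with zeros agree on all other coordinates)
dist₁ : {n : ℕ} → Vec ℕ n → Vec ℕ n → ℕ
dist₁ u v = sum (zipWith ∣_-_∣ u v)

-- The partitions are read off from a code. A greedy (Gilbert–Varshamov) code of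
-- length L = K·M over the digits 0,…,7 with pairwise Hamming distance > L/2 has
-- T ≥ 2^(L/2) words. A word is cut into K blocks of M digits; on level k of the
-- ladder each digit s becomes 2^k equal parts of size c·2^(K-1-k)·(7(M+t)+s),
-- where t counts the digits after s in its block. The offsets 7(M+t) make the
-- parts non-increasing across digits and levels, and since the multiplicity
-- times the scale is c·2^(K-1) on every level, the ℓ1 distance of two ladders is
-- c·2^(K-1) times the digit distance of the words, which lies between the
-- Hamming distance and 7 times it. Taking M = ⌊n/Δ⌋, K maximal with
-- 7·2^K·K·M ≤ Δ and c = ⌊Δ/(7·2^K·K·M)⌋ puts all distances in [Δ/56, Δ/2],
-- keeps every size below M·Δ ≤ n, and Δ² ≤ n·2^(6K) turns T² ≥ 2^(KM) into
-- Δ^(2n) ≤ T^(24Δ)·n^n.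
module Submission where

import Algebra.Properties.CommutativeSemigroup as CommutativeSemigroupProperties
open import Data.Bool using (if_then_else_)
open import Data.Fin using (Fin; zero; suc; toℕ; _≟_)
open import Data.Fin.Properties using (toℕ≤pred[n]; toℕ-injective)
open import Data.List as List using (List; []; _∷_; length; allFin; cartesianProductWith)
open import Data.List.Membership.Propositional.Properties using (∈-lookup)
open import Data.List.Properties using (length-++; length-map; length-tabulate; map-tabulate)
open import Data.List.Relation.Unary.All as All using (All; []; _∷_; all?)
open import Data.List.Relation.Unary.All.Properties using (¬All⇒Any¬)
open import Data.List.Relation.Unary.AllPairs using (AllPairs; []; _∷_)
open import Data.List.Relation.Unary.Any as Any using (Any; here; there)
open import Data.Nat hiding (_≟_)
open import Data.Nat.DivMod using (m≡m%n+[m/n]*n; m%n<n; m/n*n≤m; m≥n⇒m/n>0)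
open import Data.Nat.Properties hiding (_≟_)
open import Data.Nat.Tactic.RingSolver using (solve-∀)
open import Data.Product using (Σ; Σ-syntax; ∃-syntax; _×_; _,_)
open import Data.Vec using (Vec; []; _∷_; _++_; replicate; zipWith; sum; map; take; drop; padRight)
open import Data.Vec.Properties using (take++drop≡id; map-++; zipWith-++; sum-++)
open import Data.Vec.Relation.Unary.All as VecAll using ([]; _∷_) renaming (All to VecAll)
import Data.Vec.Relation.Unary.All.Properties as VecAll
open import Data.Vec.Relation.Unary.AllPairs as VecAllPairs using ([]; _∷_) renaming (AllPairs to VecAllPairs)
import Data.Vec.Relation.Unary.AllPairs.Properties as VecAllPairs
open import Function using (_∘_; id)
open import Level using (0ℓ)
open import Relation.Binary.Definitions using (Symmetric)
open import Relation.Binary.PropositionalEquality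
open import Relation.Nullary using (¬_; does; yes; no; contradiction)
open import Relation.Unary using (Pred; Decidable)

open import Defs

module +-CS = CommutativeSemigroupProperties +-commutativeSemigroup

private
  variable
    A B C : Set
    m n : ℕ

^-distribʳ-* : ∀ a b n → (a * b) ^ n ≡ a ^ n * b ^ n
^-distribʳ-* a b zero    = refl
^-distribʳ-* a b (suc n) = trans (cong (a * b *_) (^-distribʳ-* a b n)) (interchange a b (a ^ n) (b ^ n))
  where
  interchange : ∀ a b x y → a * b * (x * y) ≡ a * x * (b * y)
  interchange = solve-∀

1+n≤2^n : ∀ n → suc n ≤ 2 ^ n
1+n≤2^n zero    = ≤-refl
1+n≤2^n (suc n) = begin
  2 + n           ≤⟨ +-monoʳ-≤ 1 (1+n≤2^n n) ⟩
  1 + 2 ^ n       ≤⟨ +-monoˡ-≤ (2 ^ n) (m^n>0 2 n) ⟩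
  2 ^ n + 2 ^ n   ≡⟨ cong (2 ^ n +_) (+-identityʳ (2 ^ n)) ⟨
  2 ^ suc n       ∎
  where open ≤-Reasoning

m<n+[m/n]*n : ∀ m n .{{_ : NonZero n}} → m < n + m / n * n
m<n+[m/n]*n m n = subst (_< n + m / n * n) (sym (m≡m%n+[m/n]*n m n)) (+-monoˡ-< (m / n * n) (m%n<n m n))

∃-boundary : ∀ {P : ℕ → Set} → Decidable P → ∀ {m} gap → P m → ¬ P (m + gap) →
             ∃[ k ] m ≤ k × P k × ¬ P (suc k)
∃-boundary {P} P? {m} zero    pm ¬pm+0 = contradiction (subst P (sym (+-identityʳ m)) pm) ¬pm+0
∃-boundary {P} P? {m} (suc g) pm ¬pm+g with P? (suc m)
... | no ¬p1+m = m , ≤-refl , pm , ¬p1+m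
... | yes p1+m =
  let k , 1+m≤k , pk , ¬p1+k = ∃-boundary P? g p1+m (subst (¬_ ∘ P) (+-suc m g) ¬pm+g)
  in  k , <⇒≤ 1+m≤k , pk , ¬p1+k

-- Codes

∑ : List A → (A → ℕ) → ℕ
∑ []       f = 0
∑ (x ∷ xs) f = f x + ∑ xs f

syntax ∑ xs (λ x → e) = ∑[ x ∈ xs ] e

∑-++ : ∀ (xs ys : List A) f → ∑ (xs List.++ ys) f ≡ ∑ xs f + ∑ ys f
∑-++ []       ys f = refl
∑-++ (x ∷ xs) ys f = trans (cong (f x +_) (∑-++ xs ys f)) (sym (+-assoc (f x) _ _))

∑-map : ∀ (g : A → B) xs f → ∑ (List.map g xs) f ≡ ∑ xs (f ∘ g)
∑-map g []       f = refl
∑-map g (x ∷ xs) f = cong (f (g x) +_) (∑-map g xs f)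

∑-mono-≤ : ∀ (xs : List A) {f g} → (∀ x → f x ≤ g x) → ∑ xs f ≤ ∑ xs g
∑-mono-≤ []       f≤g = z≤n
∑-mono-≤ (x ∷ xs) f≤g = +-mono-≤ (f≤g x) (∑-mono-≤ xs f≤g)

∑-cong : ∀ (xs : List A) {f g} → (∀ x → f x ≡ g x) → ∑ xs f ≡ ∑ xs g
∑-cong []       f≡g = refl
∑-cong (x ∷ xs) f≡g = cong₂ _+_ (f≡g x) (∑-cong xs f≡g)

∑-+ : ∀ (xs : List A) f g → ∑[ x ∈ xs ] (f x + g x) ≡ ∑ xs f + ∑ xs g
∑-+ []       f g = refl
∑-+ (x ∷ xs) f g = trans (cong (f x + g x +_) (∑-+ xs f g)) (+-CS.interchange (f x) (g x) (∑ xs f) (∑ xs g))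

∑-const : ∀ (xs : List A) k → ∑[ x ∈ xs ] k ≡ length xs * k
∑-const []       k = refl
∑-const (x ∷ xs) k = cong (k +_) (∑-const xs k)

∑-cartesianProductWith : ∀ (g : A → B → C) xs ys f →
  ∑ (cartesianProductWith g xs ys) f ≡ ∑[ x ∈ xs ] ∑[ y ∈ ys ] f (g x y)
∑-cartesianProductWith g []       ys f = refl
∑-cartesianProductWith g (x ∷ xs) ys f = begin
  ∑ (List.map (g x) ys List.++ cartesianProductWith g xs ys) f
    ≡⟨ ∑-++ (List.map (g x) ys) _ f ⟩
  ∑ (List.map (g x) ys) f + ∑ (cartesianProductWith g xs ys) f
    ≡⟨ cong₂ _+_ (∑-map (g x) ys f) (∑-cartesianProductWith g xs ys f) ⟩
  ∑ ys (f ∘ g x) + ∑[ x′ ∈ xs ] ∑[ y ∈ ys ] f (g x′ y) ∎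
  where open ≡-Reasoning

length-cartesianProductWith : ∀ (g : A → B → C) xs ys →
  length (cartesianProductWith g xs ys) ≡ length xs * length ys
length-cartesianProductWith g []       ys = refl
length-cartesianProductWith g (x ∷ xs) ys = begin
  length (List.map (g x) ys List.++ cartesianProductWith g xs ys)
    ≡⟨ length-++ (List.map (g x) ys) ⟩
  length (List.map (g x) ys) + length (cartesianProductWith g xs ys)
    ≡⟨ cong₂ _+_ (length-map (g x) ys) (length-cartesianProductWith g xs ys) ⟩
  length ys + length xs * length ys ∎
  where open ≡-Reasoning

∑-allFin-suc : ∀ n f → ∑ (allFin (suc n)) f ≡ f zero + ∑[ a ∈ allFin n ] f (suc a)
∑-allFin-suc n f = cong (f zero +_) (begin
  ∑ (List.tabulate suc) f            ≡⟨ cong (λ as → ∑ as f) (map-tabulate id suc) ⟨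
  ∑ (List.map suc (allFin n)) f      ≡⟨ ∑-map suc (allFin n) f ⟩
  ∑[ a ∈ allFin n ] f (suc a)        ∎)
  where open ≡-Reasoning

∑-allFin-≟ : ∀ d (c : Fin (suc d)) X Y →
  ∑[ a ∈ allFin (suc d) ] (if does (a ≟ c) then X else Y) ≡ X + d * Y
∑-allFin-≟ d zero X Y = trans (∑-allFin-suc d (λ a → if does (a ≟ zero) then X else Y)) (cong (X +_) (begin
  ∑[ a ∈ allFin d ] Y   ≡⟨ ∑-const (allFin d) Y ⟩
  length (allFin d) * Y ≡⟨ cong (_* Y) (length-tabulate {n = d} id) ⟩
  d * Y                 ∎))
  where open ≡-Reasoning
∑-allFin-≟ (suc d) (suc c) X Y = begin
  ∑[ a ∈ allFin (suc (suc d)) ] (if does (a ≟ suc c) then X else Y) ≡⟨ ∑-allFin-suc (suc d) (λ a → if does (a ≟ suc c) then X else Y) ⟩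
  Y + ∑[ a ∈ allFin (suc d) ] (if does (a ≟ c) then X else Y)       ≡⟨ cong (Y +_) (∑-allFin-≟ d c X Y) ⟩
  Y + (X + d * Y)                                                 ≡⟨ +-CS.x∙yz≈y∙xz Y X (d * Y) ⟩
  X + suc d * Y                                                   ∎
  where open ≡-Reasoning

count : {P : Pred A 0ℓ} → Decidable P → List A → ℕ
count P? xs = ∑[ x ∈ xs ] (if does (P? x) then 1 else 0)

Any⇒0<count : {P : Pred A 0ℓ} (P? : Decidable P) {xs : List A} → Any P xs → 0 < count P? xs
Any⇒0<count P? {x ∷ xs} (here px) with P? x
... | yes _   = s≤s z≤n
... | no ¬px  = contradiction px ¬px
Any⇒0<count P? {x ∷ xs} (there pxs) = ≤-trans (Any⇒0<count P? pxs) (m≤n+m _ _)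

length≤∑-count : {R : A → B → Set} (R? : ∀ c → Decidable (R c)) (cs : List A) (xs : List B) →
  All (λ x → Any (λ c → R c x) cs) xs → length xs ≤ ∑[ c ∈ cs ] count (R? c) xs
length≤∑-count R? cs []       []                 = z≤n
length≤∑-count R? cs (x ∷ xs) (x-covered ∷ covered) = begin
  suc (length xs)
    ≤⟨ +-mono-≤ (Any⇒0<count (λ c → R? c x) x-covered) (length≤∑-count R? cs xs covered) ⟩
  count (λ c → R? c x) cs + ∑[ c ∈ cs ] count (R? c) xs
    ≡⟨ ∑-+ cs (λ c → if does (R? c x) then 1 else 0) (λ c → count (R? c) xs) ⟨
  ∑[ c ∈ cs ] count (R? c) (x ∷ xs) ∎
  where open ≤-Reasoning

module _ {q : ℕ} where

  mismatch : Fin q → Fin q → ℕ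
  mismatch a b = if does (a ≟ b) then 0 else 1

  hamming : ∀ {L} → Vec (Fin q) L → Vec (Fin q) L → ℕ
  hamming x y = sum (zipWith mismatch x y)

  mismatch-self : ∀ a → mismatch a a ≡ 0
  mismatch-self a with a ≟ a
  ... | yes _  = refl
  ... | no a≢a = contradiction refl a≢a

  mismatch-comm : ∀ a b → mismatch a b ≡ mismatch b a
  mismatch-comm a b with a ≟ b | b ≟ a
  ... | yes _   | yes _   = refl
  ... | no  _   | no  _   = refl
  ... | yes a≡b | no  b≢a = contradiction (sym a≡b) b≢a
  ... | no  a≢b | yes b≡a = contradiction (sym b≡a) a≢b

  mismatch≤1 : ∀ a b → mismatch a b ≤ 1
  mismatch≤1 a b with a ≟ b
  ... | yes _ = z≤n
  ... | no  _ = ≤-refl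

  hamming-self : ∀ {L} (x : Vec (Fin q) L) → hamming x x ≡ 0
  hamming-self []      = refl
  hamming-self (a ∷ x) = cong₂ _+_ (mismatch-self a) (hamming-self x)

  hamming-comm : ∀ {L} (x y : Vec (Fin q) L) → hamming x y ≡ hamming y x
  hamming-comm []      []      = refl
  hamming-comm (a ∷ x) (b ∷ y) = cong₂ _+_ (mismatch-comm a b) (hamming-comm x y)

  hamming≤length : ∀ {L} (x y : Vec (Fin q) L) → hamming x y ≤ L
  hamming≤length []      []      = z≤n
  hamming≤length (a ∷ x) (b ∷ y) = +-mono-≤ (mismatch≤1 a b) (hamming≤length x y)

  mismatch≤∣-∣ : ∀ a b → mismatch a b ≤ ∣ toℕ a - toℕ b ∣
  mismatch≤∣-∣ a b with a ≟ b
  ... | yes _ = z≤n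
  ... | no a≢b with ∣ toℕ a - toℕ b ∣ in eq
  ...   | zero  = contradiction (toℕ-injective (∣m-n∣≡0⇒m≡n eq)) a≢b
  ...   | suc _ = s≤s z≤n

  hamming≤dist₁ : ∀ {L} (x y : Vec (Fin q) L) → hamming x y ≤ dist₁ (map toℕ x) (map toℕ y)
  hamming≤dist₁ []      []      = z≤n
  hamming≤dist₁ (a ∷ x) (b ∷ y) = +-mono-≤ (mismatch≤∣-∣ a b) (hamming≤dist₁ x y)

∣-∣≤d*mismatch : ∀ {d} (a b : Fin (suc d)) → ∣ toℕ a - toℕ b ∣ ≤ d * mismatch a b
∣-∣≤d*mismatch {d} a b with a ≟ b
... | yes refl = ≤-reflexive (trans (∣n-n∣≡0 (toℕ a)) (sym (*-zeroʳ d)))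
... | no  _    = begin
  ∣ toℕ a - toℕ b ∣ ≤⟨ ∣m-n∣≤m⊔n (toℕ a) (toℕ b) ⟩
  toℕ a ⊔ toℕ b     ≤⟨ ⊔-lub (toℕ≤pred[n] a) (toℕ≤pred[n] b) ⟩
  d                 ≡⟨ *-identityʳ d ⟨
  d * 1             ∎
  where open ≤-Reasoning

dist₁≤d*hamming : ∀ {d L} (x y : Vec (Fin (suc d)) L) → dist₁ (map toℕ x) (map toℕ y) ≤ d * hamming x y
dist₁≤d*hamming {d} []      []      = ≤-reflexive (sym (*-zeroʳ d))
dist₁≤d*hamming {d} (a ∷ x) (b ∷ y) = begin
  ∣ toℕ a - toℕ b ∣ + dist₁ (map toℕ x) (map toℕ y) ≤⟨ +-mono-≤ (∣-∣≤d*mismatch a b) (dist₁≤d*hamming x y) ⟩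
  d * mismatch a b + d * hamming x y                ≡⟨ *-distribˡ-+ d (mismatch a b) (hamming x y) ⟨
  d * (mismatch a b + hamming x y)                  ∎
  where open ≤-Reasoning

words : ∀ q L → List (Vec (Fin q) L)
words q zero    = [] ∷ []
words q (suc L) = cartesianProductWith _∷_ (allFin q) (words q L)

length-words : ∀ q L → length (words q L) ≡ q ^ L
length-words q zero    = refl
length-words q (suc L) = trans (length-cartesianProductWith _∷_ (allFin q) (words q L))
                               (cong₂ _*_ (length-tabulate {n = q} id) (length-words q L))

ball-size : ∀ {d} L h (c : Vec (Fin (suc d)) L) →
  count (λ x → hamming x c <? suc h) (words (suc d) L) ≤ 2 ^ L * suc d ^ h
ball-size {d} zero    h []       = ≤-trans (m^n>0 (suc d) h) (≤-reflexive (sym (*-identityˡ _)))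
ball-size {d} (suc L) h (c₀ ∷ c) = begin
  count (λ x → hamming x (c₀ ∷ c) <? suc h) (words q (suc L))
    ≡⟨ ∑-cartesianProductWith _∷_ (allFin q) (words q L) _ ⟩
  ∑[ a ∈ allFin q ] count (λ x → mismatch a c₀ + hamming x c <? suc h) (words q L)
    ≡⟨ ∑-cong (allFin q) first-digit ⟩
  ∑[ a ∈ allFin q ] (if does (a ≟ c₀) then inner else outer)
    ≡⟨ ∑-allFin-≟ d c₀ inner outer ⟩
  inner + d * outer
    ≤⟨ +-mono-≤ (ball-size L h c) (shell h) ⟩
  2 ^ L * q ^ h + 2 ^ L * q ^ h
    ≡⟨ double (2 ^ L) (q ^ h) ⟩
  2 ^ suc L * q ^ h ∎
  where
  open ≤-Reasoning
  q = suc d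
  inner outer : ℕ
  inner = count (λ x → hamming x c <? suc h) (words q L)
  outer = count (λ x → suc (hamming x c) <? suc h) (words q L)
  first-digit : ∀ a → count (λ x → mismatch a c₀ + hamming x c <? suc h) (words q L)
                      ≡ (if does (a ≟ c₀) then inner else outer)
  first-digit a with a ≟ c₀
  ... | yes _ = refl
  ... | no  _ = refl
  shell : ∀ h → d * count (λ x → suc (hamming x c) <? suc h) (words q L) ≤ 2 ^ L * q ^ h
  shell zero     = ≤-trans (≤-reflexive nothing-inside) z≤n
    where
    nothing-inside : d * count (λ x → suc (hamming x c) <? 1) (words q L) ≡ 0
    nothing-inside = trans (cong (d *_) (trans (∑-const (words q L) 0) (*-zeroʳ (length (words q L))))) (*-zeroʳ d)
  shell (suc h′) = ≤-trans (*-mono-≤ (n≤1+n d) (ball-size L h′ c)) (≤-reflexive (*-comm-middle q (2 ^ L) (q ^ h′)))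
    where
    *-comm-middle : ∀ a b c → a * (b * c) ≡ b * (a * c)
    *-comm-middle = solve-∀
  double : ∀ a b → a * b + a * b ≡ 2 * a * b
  double = solve-∀

module _ {q L : ℕ} (r : ℕ) where

  greedy : List (Vec (Fin q) L) → List (Vec (Fin q) L) → List (Vec (Fin q) L)
  greedy C []       = C
  greedy C (x ∷ xs) with all? (λ c → r ≤? hamming x c) C
  ... | yes _ = greedy (x ∷ C) xs
  ... | no  _ = greedy C xs

  greedy-separated : ∀ {C} xs → AllPairs (λ x y → r ≤ hamming x y) C →
                     AllPairs (λ x y → r ≤ hamming x y) (greedy C xs)
  greedy-separated {C} []       sep = sep
  greedy-separated {C} (x ∷ xs) sep with all? (λ c → r ≤? hamming x c) C
  ... | yes x-far = greedy-separated xs (x-far ∷ sep)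
  ... | no  _     = greedy-separated xs sep

  greedy-Any⁺ : {P : Pred (Vec (Fin q) L) 0ℓ} {C : List (Vec (Fin q) L)} → ∀ xs → Any P C → Any P (greedy C xs)
  greedy-Any⁺ {C = C} []       p = p
  greedy-Any⁺ {C = C} (x ∷ xs) p with all? (λ c → r ≤? hamming x c) C
  ... | yes _ = greedy-Any⁺ xs (there p)
  ... | no  _ = greedy-Any⁺ xs p

  greedy-covers : 0 < r → ∀ {C} xs → All (λ x → Any (λ c → hamming x c < r) (greedy C xs)) xs
  greedy-covers 0<r {C} []       = []
  greedy-covers 0<r {C} (x ∷ xs) with all? (λ c → r ≤? hamming x c) C
  ... | yes _      = greedy-Any⁺ xs (here (subst (_< r) (sym (hamming-self x)) 0<r)) ∷ greedy-covers 0<r xs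
  ... | no  x-near = greedy-Any⁺ xs (Any.map ≰⇒> (¬All⇒Any¬ (λ c → r ≤? hamming x c) C x-near)) ∷ greedy-covers 0<r xs

gilbert-varshamov : ∀ d L h →
  Σ[ code ∈ List (Vec (Fin (suc d)) L) ] AllPairs (λ x y → h < hamming x y) code ×
                                         suc d ^ L ≤ length code * (2 ^ L * suc d ^ h)
gilbert-varshamov d L h = code , greedy-separated (suc h) (words q L) [] , (begin
  q ^ L                                                 ≡⟨ length-words q L ⟨
  length (words q L)                                    ≤⟨ length≤∑-count (λ c x → hamming x c <? suc h) code (words q L)
                                                             (greedy-covers (suc h) (s≤s z≤n) (words q L)) ⟩
  ∑[ c ∈ code ] count (λ x → hamming x c <? suc h) (words q L) ≤⟨ ∑-mono-≤ code (λ c → ball-size L h c) ⟩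
  ∑[ c ∈ code ] (2 ^ L * q ^ h)                            ≡⟨ ∑-const code _ ⟩
  length code * (2 ^ L * q ^ h)                            ∎)
  where
  open ≤-Reasoning
  q = suc d
  code = greedy (suc h) [] (words q L)

AllPairs-lookup : {R : A → A → Set} → Symmetric R → ∀ {xs} → AllPairs R xs →
  ∀ i j → i ≢ j → R (List.lookup xs i) (List.lookup xs j)
AllPairs-lookup R-sym (x-R ∷ R-xs) zero    zero    i≢j = contradiction refl i≢j
AllPairs-lookup R-sym (x-R ∷ R-xs) zero    (suc j) _   = All.lookup x-R (∈-lookup j)
AllPairs-lookup R-sym (x-R ∷ R-xs) (suc i) zero    _   = R-sym (All.lookup x-R (∈-lookup i))
AllPairs-lookup R-sym (x-R ∷ R-xs) (suc i) (suc j) i≢j = AllPairs-lookup R-sym R-xs i j (i≢j ∘ cong suc)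

rate-bound : ∀ L h T → 2 * h ≤ L → 8 ^ L ≤ T * (2 ^ L * 8 ^ h) → 2 ^ L ≤ T ^ 2
rate-bound L h T 2h≤L 8^L≤ = subst (P ≤_) (cong (T *_) (sym (*-identityʳ T)))
  (*-cancelʳ-≤ P (T * T) (P * P) {{P*P≢0}} (*-cancelʳ-≤ (P * (P * P)) (T * T * (P * P)) E {{E≢0}} (begin
  P * (P * P) * E                     ≡⟨ cong (_* E) (sym cube) ⟩
  E * E                               ≤⟨ *-mono-≤ 8^L≤ 8^L≤ ⟩
  T * (P * Q) * (T * (P * Q))         ≡⟨ regroup T P Q ⟩
  T * T * (P * P) * (Q * Q)           ≤⟨ *-monoʳ-≤ (T * T * (P * P)) Q*Q≤E ⟩
  T * T * (P * P) * E                 ∎)))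
  where
  open ≤-Reasoning
  P = 2 ^ L
  Q = 8 ^ h
  E = 8 ^ L
  E≢0 = m^n≢0 8 L
  P*P≢0 = m*n≢0 P P {{m^n≢0 2 L}} {{m^n≢0 2 L}}
  cube : E ≡ P * (P * P)
  cube = trans (^-distribʳ-* 2 4 L) (cong (P *_) (^-distribʳ-* 2 2 L))
  Q*Q≤E : Q * Q ≤ E
  Q*Q≤E = begin
    Q * Q     ≡⟨ ^-distribˡ-+-* 8 h h ⟨
    8 ^ (h + h) ≤⟨ ^-monoʳ-≤ 8 (≤-trans (≤-reflexive (cong (h +_) (sym (+-identityʳ h)))) 2h≤L) ⟩
    E         ∎
  regroup : ∀ T P Q → T * (P * Q) * (T * (P * Q)) ≡ T * T * (P * P) * (Q * Q)
  regroup = solve-∀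

octal-code : ∀ L → ∃[ h ] L ≤ 2 * suc h ×
  Σ[ code ∈ List (Vec (Fin 8) L) ] AllPairs (λ x y → h < hamming x y) code × 2 ^ L ≤ length code ^ 2
octal-code L =
  let code , separated , 8^L≤ = gilbert-varshamov 7 L h
  in  h , L≤2[1+h] , code , separated , rate-bound L h (length code) 2h≤L 8^L≤
  where
  h = L / 2
  2h≤L : 2 * h ≤ L
  2h≤L = subst (_≤ L) (*-comm h 2) (m/n*n≤m L 2)
  L≤2[1+h] : L ≤ 2 * suc h
  L≤2[1+h] = ≤-trans (<⇒≤ (m<n+[m/n]*n L 2)) (≤-reflexive (two-halves h))
    where
    two-halves : ∀ h → 2 + h * 2 ≡ 2 * suc h
    two-halves = solve-∀

-- Ladders

Descending : Vec ℕ n → Set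
Descending = VecAllPairs _≥_

VecAll-replicate : ∀ {P : ℕ → Set} ℓ {a} → P a → VecAll P (replicate ℓ a)
VecAll-replicate zero    pa = []
VecAll-replicate (suc ℓ) pa = pa ∷ VecAll-replicate ℓ pa

replicate-descending : ∀ ℓ a → Descending (replicate ℓ a)
replicate-descending zero    a = []
replicate-descending (suc ℓ) a = VecAll-replicate ℓ ≤-refl ∷ replicate-descending ℓ a

++-descending : ∀ {b} {xs : Vec ℕ m} {ys : Vec ℕ n} →
  Descending xs → Descending ys → VecAll (b ≤_) xs → VecAll (_≤ b) ys → Descending (xs ++ ys)
++-descending xs↓ ys↓ xs≥b ys≤b =
  VecAllPairs.++⁺ xs↓ ys↓ (VecAll.map (λ b≤x → VecAll.map (λ y≤b → ≤-trans y≤b b≤x) ys≤b) xs≥b)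

VecAll-padRight : ∀ {P : ℕ → Set} {a} (le : m ≤ n) {xs : Vec ℕ m} → P a → VecAll P xs → VecAll P (padRight le a xs)
VecAll-padRight {n = n} z≤n pa [] = VecAll-replicate n pa
VecAll-padRight (s≤s le)  pa (px ∷ pxs) = px ∷ VecAll-padRight le pa pxs

padRight-descending : ∀ (le : m ≤ n) {xs : Vec ℕ m} → Descending xs → Descending (padRight le 0 xs)
padRight-descending {n = n} z≤n [] = replicate-descending n 0
padRight-descending (s≤s le) (x≥ ∷ xs↓) = VecAll-padRight le z≤n x≥ ∷ padRight-descending le xs↓

descending⇒NonIncreasing : {v : Vec ℕ n} → Descending v → NonIncreasing v
descending⇒NonIncreasing (x≥ ∷ v↓) zero    zero    _        = ≤-refl
descending⇒NonIncreasing (x≥ ∷ v↓) zero    (suc j) _        = VecAll.lookup⁺ x≥ j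
descending⇒NonIncreasing (x≥ ∷ v↓) (suc i) (suc j) (s≤s i≤j) = descending⇒NonIncreasing v↓ i j i≤j

sum≤length*bound : ∀ {b} {xs : Vec ℕ n} → VecAll (_≤ b) xs → sum xs ≤ n * b
sum≤length*bound []         = z≤n
sum≤length*bound (x≤ ∷ xs≤) = +-mono-≤ x≤ (sum≤length*bound xs≤)

sum-padRight : ∀ (le : m ≤ n) (xs : Vec ℕ m) → sum (padRight le 0 xs) ≡ sum xs
sum-padRight {n = n} z≤n [] = sum-replicate-0 n
  where
  sum-replicate-0 : ∀ n → sum (replicate n 0) ≡ 0
  sum-replicate-0 zero    = refl
  sum-replicate-0 (suc n) = sum-replicate-0 n
sum-padRight (s≤s le) (x ∷ xs) = cong (x +_) (sum-padRight le xs)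

dist₁-self : ∀ (v : Vec ℕ n) → dist₁ v v ≡ 0
dist₁-self []      = refl
dist₁-self (x ∷ v) = cong₂ _+_ (∣n-n∣≡0 x) (dist₁-self v)

dist₁-++ : ∀ (xs xs′ : Vec ℕ m) (ys ys′ : Vec ℕ n) →
  dist₁ (xs ++ ys) (xs′ ++ ys′) ≡ dist₁ xs xs′ + dist₁ ys ys′
dist₁-++ xs xs′ ys ys′ = trans (cong sum (zipWith-++ ∣_-_∣ xs ys xs′ ys′)) (sum-++ (zipWith ∣_-_∣ xs xs′))

dist₁-replicate : ∀ ℓ a b → dist₁ (replicate ℓ a) (replicate ℓ b) ≡ ℓ * ∣ a - b ∣
dist₁-replicate zero    a b = refl
dist₁-replicate (suc ℓ) a b = cong (∣ a - b ∣ +_) (dist₁-replicate ℓ a b)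

dist₁-padRight : ∀ (le : m ≤ n) (xs ys : Vec ℕ m) → dist₁ (padRight le 0 xs) (padRight le 0 ys) ≡ dist₁ xs ys
dist₁-padRight {n = n} z≤n [] [] = dist₁-self (replicate n 0)
dist₁-padRight (s≤s le) (x ∷ xs) (y ∷ ys) = cong (∣ x - y ∣ +_) (dist₁-padRight le xs ys)

dist₁-take-drop : ∀ {q} m (x y : Vec (Fin q) (m + n)) →
  dist₁ (map toℕ x) (map toℕ y) ≡
  dist₁ (map toℕ (take m x)) (map toℕ (take m y)) + dist₁ (map toℕ (drop m x)) (map toℕ (drop m y))
dist₁-take-drop m x y = begin
  dist₁ (map toℕ x) (map toℕ y)
    ≡⟨ cong₂ (λ x y → dist₁ (map toℕ x) (map toℕ y)) (take++drop≡id m x) (take++drop≡id m y) ⟨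
  dist₁ (map toℕ (take m x ++ drop m x)) (map toℕ (take m y ++ drop m y))
    ≡⟨ cong₂ dist₁ (map-++ toℕ (take m x) (drop m x)) (map-++ toℕ (take m y) (drop m y)) ⟩
  dist₁ (map toℕ (take m x) ++ map toℕ (drop m x)) (map toℕ (take m y) ++ map toℕ (drop m y))
    ≡⟨ dist₁-++ (map toℕ (take m x)) _ (map toℕ (drop m x)) _ ⟩
  dist₁ (map toℕ (take m x)) (map toℕ (take m y)) + dist₁ (map toℕ (drop m x)) (map toℕ (drop m y)) ∎
  where open ≡-Reasoning

module _ (d : ℕ) where

  block : (ℓ U B : ℕ) {t : ℕ} → Vec (Fin (suc d)) t → Vec ℕ (t * ℓ)
  block ℓ U B []                = []
  block ℓ U B {suc t} (s ∷ x) = replicate ℓ (U * (d * (B + t) + toℕ s)) ++ block ℓ U B x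

  block-dist : ∀ ℓ U B {t} (x y : Vec (Fin (suc d)) t) →
    dist₁ (block ℓ U B x) (block ℓ U B y) ≡ ℓ * U * dist₁ (map toℕ x) (map toℕ y)
  block-dist ℓ U B []      []      = sym (*-zeroʳ (ℓ * U))
  block-dist ℓ U B {suc t} (a ∷ x) (b ∷ y) = begin
    dist₁ (replicate ℓ (U * (o + toℕ a)) ++ block ℓ U B x) (replicate ℓ (U * (o + toℕ b)) ++ block ℓ U B y)
      ≡⟨ dist₁-++ (replicate ℓ _) (replicate ℓ _) (block ℓ U B x) (block ℓ U B y) ⟩
    dist₁ (replicate ℓ (U * (o + toℕ a))) (replicate ℓ (U * (o + toℕ b))) + dist₁ (block ℓ U B x) (block ℓ U B y)
      ≡⟨ cong₂ _+_ (dist₁-replicate ℓ _ _) (block-dist ℓ U B x y) ⟩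
    ℓ * ∣ U * (o + toℕ a) - U * (o + toℕ b) ∣ + ℓ * U * dist₁ (map toℕ x) (map toℕ y)
      ≡⟨ cong (λ e → ℓ * e + ℓ * U * dist₁ (map toℕ x) (map toℕ y)) (*-distribˡ-∣-∣ U (o + toℕ a) (o + toℕ b)) ⟨
    ℓ * (U * ∣ o + toℕ a - o + toℕ b ∣) + ℓ * U * dist₁ (map toℕ x) (map toℕ y)
      ≡⟨ cong (λ e → ℓ * (U * e) + ℓ * U * dist₁ (map toℕ x) (map toℕ y)) (∣m+n-m+o∣≡∣n-o∣ o (toℕ a) (toℕ b)) ⟩
    ℓ * (U * ∣ toℕ a - toℕ b ∣) + ℓ * U * dist₁ (map toℕ x) (map toℕ y)
      ≡⟨ factor ℓ U ∣ toℕ a - toℕ b ∣ (dist₁ (map toℕ x) (map toℕ y)) ⟩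
    ℓ * U * (∣ toℕ a - toℕ b ∣ + dist₁ (map toℕ x) (map toℕ y)) ∎
    where
    open ≡-Reasoning
    o = d * (B + t)
    factor : ∀ l u e f → l * (u * e) + l * u * f ≡ l * u * (e + f)
    factor = solve-∀

  block-≥ : ∀ ℓ U B {t} (x : Vec (Fin (suc d)) t) → VecAll (U * (d * B) ≤_) (block ℓ U B x)
  block-≥ ℓ U B []      = []
  block-≥ ℓ U B {suc t} (s ∷ x) = VecAll.++⁺
    (VecAll-replicate ℓ (*-monoʳ-≤ U (≤-trans (*-monoʳ-≤ d (m≤m+n B t)) (m≤m+n _ (toℕ s)))))
    (block-≥ ℓ U B x)

  digit+offset≤ : ∀ B t (s : Fin (suc d)) → d * (B + t) + toℕ s ≤ d * (B + suc t)
  digit+offset≤ B t s = begin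
    d * (B + t) + toℕ s ≤⟨ +-monoʳ-≤ (d * (B + t)) (toℕ≤pred[n] s) ⟩
    d * (B + t) + d     ≡⟨ shift d B t ⟩
    d * (B + suc t)     ∎
    where
    open ≤-Reasoning
    shift : ∀ d B t → d * (B + t) + d ≡ d * (B + suc t)
    shift = solve-∀

  block-≤ : ∀ ℓ U B {t} (x : Vec (Fin (suc d)) t) → VecAll (_≤ U * (d * (B + t))) (block ℓ U B x)
  block-≤ ℓ U B []      = []
  block-≤ ℓ U B {suc t} (s ∷ x) = VecAll.++⁺
    (VecAll-replicate ℓ (*-monoʳ-≤ U (digit+offset≤ B t s)))
    (VecAll.map (λ e≤ → ≤-trans e≤ (*-monoʳ-≤ U (*-monoʳ-≤ d (+-monoʳ-≤ B (n≤1+n t))))) (block-≤ ℓ U B x))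

  block-descending : ∀ ℓ U B {t} (x : Vec (Fin (suc d)) t) → Descending (block ℓ U B x)
  block-descending ℓ U B []      = []
  block-descending ℓ U B {suc t} (s ∷ x) = ++-descending
    (replicate-descending ℓ _) (block-descending ℓ U B x)
    (VecAll-replicate ℓ (*-monoʳ-≤ U (m≤m+n _ (toℕ s)))) (block-≤ ℓ U B x)

rows : (M ℓ K : ℕ) → ℕ
rows M ℓ zero    = 0
rows M ℓ (suc K) = M * ℓ + rows M (2 * ℓ) K

rows-+ : ∀ M ℓ K → rows M ℓ K + M * ℓ ≡ M * ℓ * 2 ^ K
rows-+ M ℓ zero    = sym (*-identityʳ (M * ℓ))
rows-+ M ℓ (suc K) = begin
  M * ℓ + rows M (2 * ℓ) K + M * ℓ ≡⟨ regroup M ℓ (rows M (2 * ℓ) K) ⟩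
  rows M (2 * ℓ) K + M * (2 * ℓ)   ≡⟨ rows-+ M (2 * ℓ) K ⟩
  M * (2 * ℓ) * 2 ^ K              ≡⟨ *-2-shift M ℓ (2 ^ K) ⟩
  M * ℓ * 2 ^ suc K                ∎
  where
  open ≡-Reasoning
  regroup : ∀ M ℓ r → M * ℓ + r + M * ℓ ≡ r + M * (2 * ℓ)
  regroup = solve-∀
  *-2-shift : ∀ M ℓ P → M * (2 * ℓ) * P ≡ M * ℓ * (2 * P)
  *-2-shift = solve-∀

module _ (d M : ℕ) where

  ladder : (ℓ c K : ℕ) → Vec (Fin (suc d)) (K * M) → Vec ℕ (rows M ℓ K)
  ladder ℓ c zero    x = []
  ladder ℓ c (suc K) x = block d ℓ (c * 2 ^ K) M (take M x) ++ ladder (2 * ℓ) c K (drop M x)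

  ladder-dist : ∀ ℓ c K (x y : Vec (Fin (suc d)) (K * M)) →
    2 * dist₁ (ladder ℓ c K x) (ladder ℓ c K y) ≡ ℓ * (c * 2 ^ K) * dist₁ (map toℕ x) (map toℕ y)
  ladder-dist ℓ c zero    [] [] = sym (*-zeroʳ (ℓ * (c * 1)))
  ladder-dist ℓ c (suc K) x  y  = begin
    2 * dist₁ (block d ℓ U M (take M x) ++ ladder (2 * ℓ) c K (drop M x))
              (block d ℓ U M (take M y) ++ ladder (2 * ℓ) c K (drop M y))
      ≡⟨ cong (2 *_) (dist₁-++ (block d ℓ U M (take M x)) _ (ladder (2 * ℓ) c K (drop M x)) _) ⟩
    2 * (dist₁ (block d ℓ U M (take M x)) (block d ℓ U M (take M y)) + dist₁ (ladder (2 * ℓ) c K (drop M x)) (ladder (2 * ℓ) c K (drop M y)))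
      ≡⟨ *-distribˡ-+ 2 (dist₁ (block d ℓ U M (take M x)) _) (dist₁ (ladder (2 * ℓ) c K (drop M x)) _) ⟩
    2 * dist₁ (block d ℓ U M (take M x)) (block d ℓ U M (take M y)) + 2 * dist₁ (ladder (2 * ℓ) c K (drop M x)) (ladder (2 * ℓ) c K (drop M y))
      ≡⟨ cong₂ _+_ (cong (2 *_) (block-dist d ℓ U M (take M x) (take M y))) (ladder-dist (2 * ℓ) c K (drop M x) (drop M y)) ⟩
    2 * (ℓ * U * top) + 2 * ℓ * U * bottom
      ≡⟨ factor ℓ c (2 ^ K) top bottom ⟩
    ℓ * (c * 2 ^ suc K) * (top + bottom)
      ≡⟨ cong (ℓ * (c * 2 ^ suc K) *_) (dist₁-take-drop M x y) ⟨
    ℓ * (c * 2 ^ suc K) * dist₁ (map toℕ x) (map toℕ y) ∎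
    where
    open ≡-Reasoning
    U = c * 2 ^ K
    top    = dist₁ (map toℕ (take M x)) (map toℕ (take M y))
    bottom = dist₁ (map toℕ (drop M x)) (map toℕ (drop M y))
    factor : ∀ l c P t b → 2 * (l * (c * P) * t) + 2 * l * (c * P) * b ≡ l * (c * (2 * P)) * (t + b)
    factor = solve-∀

  ladder-≤ : ∀ ℓ c K (x : Vec (Fin (suc d)) (K * M)) → VecAll (_≤ c * 2 ^ K * (d * M)) (ladder ℓ c K x)
  ladder-≤ ℓ c zero    x = []
  ladder-≤ ℓ c (suc K) x = VecAll.++⁺
    (VecAll.map (λ e≤ → ≤-trans e≤ (≤-reflexive (double-level c (2 ^ K) d M))) (block-≤ d ℓ (c * 2 ^ K) M (take M x)))
    (VecAll.map (λ e≤ → ≤-trans e≤ (*-monoˡ-≤ (d * M) (*-monoʳ-≤ c (m≤m+n (2 ^ K) (2 ^ K + 0)))))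
             (ladder-≤ (2 * ℓ) c K (drop M x)))
    where
    double-level : ∀ c P d M → c * P * (d * (M + M)) ≡ c * (2 * P) * (d * M)
    double-level = solve-∀

  ladder-descending : ∀ ℓ c K (x : Vec (Fin (suc d)) (K * M)) → Descending (ladder ℓ c K x)
  ladder-descending ℓ c zero    x = []
  ladder-descending ℓ c (suc K) x = ++-descending
    (block-descending d ℓ (c * 2 ^ K) M (take M x)) (ladder-descending (2 * ℓ) c K (drop M x))
    (block-≥ d ℓ (c * 2 ^ K) M (take M x)) (ladder-≤ (2 * ℓ) c K (drop M x))

  ladder-sum : ∀ ℓ c K (x : Vec (Fin (suc d)) (K * M)) →
    sum (ladder ℓ c K x) ≤ K * (d * M * M) * (ℓ * (c * 2 ^ K))
  ladder-sum ℓ c zero    x = z≤n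
  ladder-sum ℓ c (suc K) x = begin
    sum (block d ℓ U M (take M x) ++ ladder (2 * ℓ) c K (drop M x))
      ≡⟨ sum-++ (block d ℓ U M (take M x)) ⟩
    sum (block d ℓ U M (take M x)) + sum (ladder (2 * ℓ) c K (drop M x))
      ≤⟨ +-mono-≤ (sum≤length*bound (block-≤ d ℓ U M (take M x))) (ladder-sum (2 * ℓ) c K (drop M x)) ⟩
    M * ℓ * (U * (d * (M + M))) + K * (d * M * M) * (2 * ℓ * U)
      ≡⟨ collect d M ℓ c K (2 ^ K) ⟩
    suc K * (d * M * M) * (ℓ * (c * 2 ^ suc K)) ∎
    where
    open ≤-Reasoning
    U = c * 2 ^ K
    collect : ∀ d M ℓ c K P → M * ℓ * (c * P * (d * (M + M))) + K * (d * M * M) * (2 * ℓ * (c * P))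
                          ≡ (1 + K) * (d * M * M) * (ℓ * (c * (2 * P)))
    collect = solve-∀

ladder-packing : ∀ {d n} M K c h (code : List (Vec (Fin (suc d)) (K * M))) →
  AllPairs (λ x y → h < hamming x y) code →
  K * (d * M * M) * (c * 2 ^ K) ≤ n → M * 2 ^ K ≤ n →
  Σ[ p ∈ (Fin (length code) → Vec ℕ n) ] (∀ i → IsPartitionLe n (p i)) ×
    (∀ i j → i ≢ j → c * 2 ^ K * suc h ≤ 2 * dist₁ (p i) (p j) ×
                     2 * dist₁ (p i) (p j) ≤ d * (c * 2 ^ K * (K * M)))
ladder-packing {d} {n} M K c h code separated size≤n width≤n = p , partition , window
  where
  W = c * 2 ^ K
  fits : rows M 1 K ≤ n
  fits = begin
    rows M 1 K         ≤⟨ m≤m+n (rows M 1 K) (M * 1) ⟩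
    rows M 1 K + M * 1 ≡⟨ rows-+ M 1 K ⟩
    M * 1 * 2 ^ K      ≡⟨ cong (_* 2 ^ K) (*-identityʳ M) ⟩
    M * 2 ^ K          ≤⟨ width≤n ⟩
    n                  ∎
    where open ≤-Reasoning
  entry : Vec (Fin (suc d)) (K * M) → Vec ℕ n
  entry x = padRight fits 0 (ladder d M 1 c K x)
  p : Fin (length code) → Vec ℕ n
  p i = entry (List.lookup code i)
  partition : ∀ i → IsPartitionLe n (p i)
  partition i = descending⇒NonIncreasing (padRight-descending fits (ladder-descending d M 1 c K x)) , (begin
    sum (entry x)              ≡⟨ sum-padRight fits (ladder d M 1 c K x) ⟩
    sum (ladder d M 1 c K x)   ≤⟨ ladder-sum d M 1 c K x ⟩
    K * (d * M * M) * (1 * W)  ≡⟨ cong (K * (d * M * M) *_) (*-identityˡ W) ⟩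
    K * (d * M * M) * W        ≤⟨ size≤n ⟩
    n                          ∎)
    where
    open ≤-Reasoning
    x = List.lookup code i
  entry-dist : ∀ x y → 2 * dist₁ (entry x) (entry y) ≡ W * dist₁ (map toℕ x) (map toℕ y)
  entry-dist x y = begin
    2 * dist₁ (entry x) (entry y)                       ≡⟨ cong (2 *_) (dist₁-padRight fits (ladder d M 1 c K x) _) ⟩
    2 * dist₁ (ladder d M 1 c K x) (ladder d M 1 c K y) ≡⟨ ladder-dist d M 1 c K x y ⟩
    1 * W * dist₁ (map toℕ x) (map toℕ y)              ≡⟨ cong (_* dist₁ (map toℕ x) (map toℕ y)) (*-identityˡ W) ⟩
    W * dist₁ (map toℕ x) (map toℕ y)                  ∎
    where open ≡-Reasoning
  window : ∀ i j → i ≢ j → W * suc h ≤ 2 * dist₁ (p i) (p j) × 2 * dist₁ (p i) (p j) ≤ d * (W * (K * M))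
  window i j i≢j = lower , upper
    where
    x = List.lookup code i
    y = List.lookup code j
    far : h < hamming x y
    far = AllPairs-lookup (λ {x} {y} h<xy → subst (h <_) (hamming-comm x y) h<xy) separated i j i≢j
    lower = begin
      W * suc h                          ≤⟨ *-monoʳ-≤ W (≤-trans far (hamming≤dist₁ x y)) ⟩
      W * dist₁ (map toℕ x) (map toℕ y)  ≡⟨ entry-dist x y ⟨
      2 * dist₁ (p i) (p j)              ∎
      where open ≤-Reasoning
    upper = begin
      2 * dist₁ (p i) (p j)              ≡⟨ entry-dist x y ⟩
      W * dist₁ (map toℕ x) (map toℕ y)  ≤⟨ *-monoʳ-≤ W (≤-trans (dist₁≤d*hamming x y) (*-monoʳ-≤ d (hamming≤length x y))) ⟩
      W * (d * (K * M))                  ≡⟨ *-comm-middle W d (K * M) ⟩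
      d * (W * (K * M))                  ∎
      where
      open ≤-Reasoning
      *-comm-middle : ∀ a b c → a * (b * c) ≡ b * (a * c)
      *-comm-middle = solve-∀

-- Choice of the parameters

7*2^[1+k]*[1+k]≤2^[6*k] : ∀ k → 1 ≤ k → 7 * (2 ^ suc k * suc k) ≤ 2 ^ (6 * k)
7*2^[1+k]*[1+k]≤2^[6*k] k 1≤k = begin
  7 * (2 ^ suc k * suc k)       ≤⟨ *-monoˡ-≤ (2 ^ suc k * suc k) (n≤1+n 7) ⟩
  8 * (2 ^ suc k * suc k)       ≤⟨ *-monoʳ-≤ 8 (*-monoʳ-≤ (2 ^ suc k) (1+n≤2^n k)) ⟩
  8 * (2 ^ suc k * 2 ^ k)       ≡⟨ powers k ⟩
  2 ^ (4 + (k + k))             ≤⟨ ^-monoʳ-≤ 2 (≤-trans (+-monoˡ-≤ (k + k) (*-monoʳ-≤ 4 1≤k)) (≤-reflexive (regroup k))) ⟩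
  2 ^ (6 * k)                   ∎
  where
  open ≤-Reasoning
  powers : ∀ k → 8 * (2 ^ suc k * 2 ^ k) ≡ 2 ^ (4 + (k + k))
  powers k = begin-equality
    8 * (2 * 2 ^ k * 2 ^ k)     ≡⟨ double-square (2 ^ k) ⟩
    2 ^ 4 * (2 ^ k * 2 ^ k)     ≡⟨ cong (2 ^ 4 *_) (^-distribˡ-+-* 2 k k) ⟨
    2 ^ 4 * 2 ^ (k + k)         ≡⟨ ^-distribˡ-+-* 2 4 (k + k) ⟨
    2 ^ (4 + (k + k))           ∎
    where
    double-square : ∀ P → 8 * (2 * P * P) ≡ 16 * (P * P)
    double-square = solve-∀
  regroup : ∀ k → 4 * k + (k + k) ≡ 6 * k
  regroup = solve-∀

Δ*Δ≤n*2^[6*K] : ∀ {n Δ M K} → 1 ≤ K → M * Δ ≤ n → Δ < 7 * (2 ^ suc K * suc K * M) → Δ * Δ ≤ n * 2 ^ (6 * K)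
Δ*Δ≤n*2^[6*K] {n} {Δ} {M} {K} 1≤K MΔ≤n Δ< = begin
  Δ * Δ                               ≤⟨ *-monoʳ-≤ Δ (<⇒≤ Δ<) ⟩
  Δ * (7 * (2 ^ suc K * suc K * M))   ≡⟨ regroup Δ (2 ^ suc K * suc K) M ⟩
  7 * (2 ^ suc K * suc K) * (M * Δ)   ≤⟨ *-mono-≤ (7*2^[1+k]*[1+k]≤2^[6*k] K 1≤K) MΔ≤n ⟩
  2 ^ (6 * K) * n                     ≡⟨ *-comm (2 ^ (6 * K)) n ⟩
  n * 2 ^ (6 * K)                     ∎
  where
  open ≤-Reasoning
  regroup : ∀ D X M → D * (7 * (X * M)) ≡ 7 * X * (M * D)
  regroup = solve-∀

exponent-bound : ∀ n Δ M K T → n ≤ 2 * (M * Δ) → Δ * Δ ≤ n * 2 ^ (6 * K) → 2 ^ (K * M) ≤ T ^ 2 →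
  Δ ^ (2 * 1 * n) ≤ T ^ (2 * 12 * Δ) * n ^ (1 * n)
exponent-bound n Δ M K T n≤2MΔ Δ²≤ 2^KM≤T² = begin
  Δ ^ (2 * 1 * n)                    ≡⟨ ^-*-assoc Δ 2 n ⟨
  (Δ * (Δ * 1)) ^ n                  ≡⟨ cong (λ e → (Δ * e) ^ n) (*-identityʳ Δ) ⟩
  (Δ * Δ) ^ n                        ≤⟨ ^-monoˡ-≤ n Δ²≤ ⟩
  (n * 2 ^ (6 * K)) ^ n              ≡⟨ ^-distribʳ-* n (2 ^ (6 * K)) n ⟩
  n ^ n * (2 ^ (6 * K)) ^ n          ≡⟨ cong (n ^ n *_) (^-*-assoc 2 (6 * K) n) ⟩
  n ^ n * 2 ^ (6 * K * n)            ≤⟨ *-monoʳ-≤ (n ^ n) (^-monoʳ-≤ 2 exponents) ⟩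
  n ^ n * 2 ^ (K * M * (12 * Δ))     ≡⟨ cong (n ^ n *_) (^-*-assoc 2 (K * M) (12 * Δ)) ⟨
  n ^ n * (2 ^ (K * M)) ^ (12 * Δ)   ≤⟨ *-monoʳ-≤ (n ^ n) (^-monoˡ-≤ (12 * Δ) 2^KM≤T²) ⟩
  n ^ n * (T ^ 2) ^ (12 * Δ)         ≡⟨ cong (n ^ n *_) (trans (^-*-assoc T 2 (12 * Δ)) (cong (T ^_) (sym (*-assoc 2 12 Δ)))) ⟩
  n ^ n * T ^ (2 * 12 * Δ)           ≡⟨ *-comm (n ^ n) _ ⟩
  T ^ (2 * 12 * Δ) * n ^ n           ≡⟨ cong (λ e → T ^ (2 * 12 * Δ) * n ^ e) (*-identityˡ n) ⟨
  T ^ (2 * 12 * Δ) * n ^ (1 * n)     ∎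
  where
  open ≤-Reasoning
  exponents : 6 * K * n ≤ K * M * (12 * Δ)
  exponents = ≤-trans (*-monoʳ-≤ (6 * K) n≤2MΔ) (≤-reflexive (regroup K M Δ))
    where
    regroup : ∀ K M Δ → 6 * K * (2 * (M * Δ)) ≡ K * M * (12 * Δ)
    regroup = solve-∀

choose-scale : ∀ Δ Y .{{_ : NonZero Y}} → Y ≤ Δ → ∃[ c ] c * Y ≤ Δ × Δ ≤ 2 * (c * Y)
choose-scale Δ Y Y≤Δ = Δ / Y , m/n*n≤m Δ Y , (begin
  Δ                       ≤⟨ <⇒≤ (m<n+[m/n]*n Δ Y) ⟩
  Y + Δ / Y * Y           ≤⟨ +-monoˡ-≤ (Δ / Y * Y) Y≤[Δ/Y]*Y ⟩
  Δ / Y * Y + Δ / Y * Y   ≡⟨ cong (Δ / Y * Y +_) (+-identityʳ (Δ / Y * Y)) ⟨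
  2 * (Δ / Y * Y)         ∎)
  where
  open ≤-Reasoning
  Y≤[Δ/Y]*Y : Y ≤ Δ / Y * Y
  Y≤[Δ/Y]*Y = ≤-trans (≤-reflexive (sym (*-identityˡ Y))) (*-monoˡ-≤ Y (m≥n⇒m/n>0 Y≤Δ))

choose-level : ∀ M Δ → 1 ≤ M → 14 * M ≤ Δ →
  ∃[ K ] 1 ≤ K × 7 * (2 ^ K * K * M) ≤ Δ × Δ < 7 * (2 ^ suc K * suc K * M)
choose-level M@(suc _) Δ@(suc δ) (s≤s z≤n) 14M≤Δ =
  let K , 1≤K , fits , ¬fits = ∃-boundary (λ K → 7 * (2 ^ K * K * M) ≤? Δ) δ fits₁ too-big
  in  K , 1≤K , fits , ≰⇒> ¬fits
  where
  fits₁ : 7 * (2 ^ 1 * 1 * M) ≤ Δ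
  fits₁ = subst (_≤ Δ) (fourteen M) 14M≤Δ
    where
    fourteen : ∀ M → 14 * M ≡ 7 * (2 * 1 * 1 * M)
    fourteen = solve-∀
  too-big : ¬ 7 * (2 ^ Δ * Δ * M) ≤ Δ
  too-big fits-Δ = <⇒≱ (begin-strict
    Δ                     <⟨ 1+n≤2^n Δ ⟩
    2 ^ Δ                 ≤⟨ m≤m*n (2 ^ Δ) Δ ⟩
    2 ^ Δ * Δ             ≤⟨ m≤m*n (2 ^ Δ * Δ) M ⟩
    2 ^ Δ * Δ * M         ≤⟨ m≤n*m (2 ^ Δ * Δ * M) 7 ⟩
    7 * (2 ^ Δ * Δ * M)   ∎) fits-Δ
    where open ≤-Reasoning

distance-window : ∀ {Δ D W L h} → 7 * (W * L) ≤ Δ → Δ ≤ 2 * (7 * (W * L)) → L ≤ 2 * suc h →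
  W * suc h ≤ 2 * D → 2 * D ≤ 7 * (W * L) → Δ ≤ 100 * D × D ≤ Δ
distance-window {Δ} {D} {W} {L} {h} Q≤Δ Δ≤2Q L≤ W[1+h]≤2D 2D≤Q = lower , upper
  where
  open ≤-Reasoning
  upper = begin
    D           ≤⟨ m≤n+m D D ⟩
    D + D       ≡⟨ cong (D +_) (+-identityʳ D) ⟨
    2 * D       ≤⟨ 2D≤Q ⟩
    7 * (W * L) ≤⟨ Q≤Δ ⟩
    Δ           ∎
  lower = begin
    Δ                         ≤⟨ Δ≤2Q ⟩
    2 * (7 * (W * L))         ≤⟨ *-monoʳ-≤ 2 (*-monoʳ-≤ 7 (*-monoʳ-≤ W L≤)) ⟩
    2 * (7 * (W * (2 * suc h))) ≡⟨ regroup W (suc h) ⟩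
    28 * (W * suc h)          ≤⟨ *-monoʳ-≤ 28 W[1+h]≤2D ⟩
    28 * (2 * D)              ≡⟨ *-assoc 28 2 D ⟨
    56 * D                    ≤⟨ *-monoˡ-≤ D (m≤m+n 56 44) ⟩
    100 * D                   ∎
    where
    regroup : ∀ W H → 2 * (7 * (W * (2 * H))) ≡ 28 * (W * H)
    regroup = solve-∀

-- The conclusion of the theorem with a = 1 and b = 12.
Packing : ℕ → ℕ → Set
Packing n Δ = Σ ℕ λ T → Σ (Fin T → Vec ℕ n) λ p →
  ((i : Fin T) → IsPartitionLe n (p i)) ×
  ((i j : Fin T) → i ≢ j → Δ ≤ 100 * dist₁ (p i) (p j) × dist₁ (p i) (p j) ≤ Δ) ×
  Δ ^ (2 * 1 * n) ≤ T ^ (2 * 12 * Δ) * n ^ (1 * n)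

packing-at-level : ∀ n Δ M K → Δ ≤ n → M * Δ ≤ n → n ≤ 2 * (M * Δ) → 1 ≤ M → 1 ≤ K →
  7 * (2 ^ K * K * M) ≤ Δ → Δ < 7 * (2 ^ suc K * suc K * M) → Packing n Δ
packing-at-level n Δ M K Δ≤n MΔ≤n n≤2MΔ 1≤M 1≤K fits ¬fits =
  let c , cY≤Δ , Δ≤2cY = choose-scale Δ Y {{Y≢0}} fits
  in  packing-at-scale c (≤-trans (≤-reflexive (scale c)) cY≤Δ)
                         (≤-trans Δ≤2cY (≤-reflexive (cong (2 *_) (sym (scale c)))))
  where
  Y = 7 * (2 ^ K * K * M)
  Y≢0 : NonZero Y
  Y≢0 = >-nonZero (*-mono-≤ (s≤s (z≤n {6})) (*-mono-≤ (*-mono-≤ (m^n>0 2 K) 1≤K) 1≤M))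
  scale : ∀ c → 7 * (c * 2 ^ K * (K * M)) ≡ c * Y
  scale c = regroup c (2 ^ K) K M
    where
    regroup : ∀ c P K M → 7 * (c * P * (K * M)) ≡ c * (7 * (P * K * M))
    regroup = solve-∀
  width≤n : M * 2 ^ K ≤ n
  width≤n = begin
    M * 2 ^ K       ≡⟨ *-comm M (2 ^ K) ⟩
    2 ^ K * M       ≤⟨ *-monoˡ-≤ M (m≤m*n (2 ^ K) K {{>-nonZero 1≤K}}) ⟩
    2 ^ K * K * M   ≤⟨ m≤n*m (2 ^ K * K * M) 7 ⟩
    Y               ≤⟨ fits ⟩
    Δ               ≤⟨ Δ≤n ⟩
    n               ∎
    where open ≤-Reasoning
  packing-at-scale : ∀ c → 7 * (c * 2 ^ K * (K * M)) ≤ Δ → Δ ≤ 2 * (7 * (c * 2 ^ K * (K * M))) → Packing n Δ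
  packing-at-scale c Q≤Δ Δ≤2Q =
    let h , L≤2[1+h] , code , separated , 2^KM≤T² = octal-code (K * M)
        p , partition , window = ladder-packing M K c h code separated size≤n width≤n
    in  length code , p , partition ,
        (λ i j i≢j → let lower , upper = window i j i≢j in distance-window {W = c * 2 ^ K} {L = K * M} Q≤Δ Δ≤2Q L≤2[1+h] lower upper) ,
        exponent-bound n Δ M K (length code) n≤2MΔ (Δ*Δ≤n*2^[6*K] 1≤K MΔ≤n ¬fits) 2^KM≤T²
    where
    size≤n : K * (7 * M * M) * (c * 2 ^ K) ≤ n
    size≤n = begin
      K * (7 * M * M) * (c * 2 ^ K)   ≡⟨ regroup K M c (2 ^ K) ⟩
      M * (7 * (c * 2 ^ K * (K * M))) ≤⟨ *-monoʳ-≤ M Q≤Δ ⟩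
      M * Δ                           ≤⟨ MΔ≤n ⟩
      n                               ∎
      where
      open ≤-Reasoning
      regroup : ∀ K M c P → K * (7 * M * M) * (c * P) ≡ M * (7 * (c * P * (K * M)))
      regroup = solve-∀

partition-packing : ∀ n Δ → Δ ≤ n → 100 * n < Δ * Δ → Packing n Δ
partition-packing n zero        Δ≤n ()
partition-packing n Δ@(suc _)   Δ≤n 100n<Δ² =
  let K , 1≤K , fits , ¬fits = choose-level M Δ 1≤M 14M≤Δ
  in  packing-at-level n Δ M K Δ≤n MΔ≤n n≤2MΔ 1≤M 1≤K fits ¬fits
  where
  open ≤-Reasoning
  M = n / Δ
  1≤M : 1 ≤ M
  1≤M = m≥n⇒m/n>0 Δ≤n
  MΔ≤n : M * Δ ≤ n
  MΔ≤n = m/n*n≤m n Δ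
  n≤2MΔ : n ≤ 2 * (M * Δ)
  n≤2MΔ = begin
    n                   ≤⟨ <⇒≤ (m<n+[m/n]*n n Δ) ⟩
    Δ + M * Δ           ≤⟨ +-monoˡ-≤ (M * Δ) (≤-trans (≤-reflexive (sym (*-identityˡ Δ))) (*-monoˡ-≤ Δ 1≤M)) ⟩
    M * Δ + M * Δ       ≡⟨ cong (M * Δ +_) (+-identityʳ (M * Δ)) ⟨
    2 * (M * Δ)         ∎
  14M≤Δ : 14 * M ≤ Δ
  14M≤Δ = <⇒≤ (*-cancelʳ-< Δ (14 * M) Δ (begin-strict
    14 * M * Δ          ≡⟨ *-assoc 14 M Δ ⟩
    14 * (M * Δ)        ≤⟨ *-monoʳ-≤ 14 MΔ≤n ⟩
    14 * n              ≤⟨ *-monoˡ-≤ n (m≤m+n 14 86) ⟩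
    100 * n             <⟨ 100n<Δ² ⟩
    Δ * Δ               ∎))

corollary1 : Σ ℕ λ a → Σ ℕ λ b → 1 ≤ a × 1 ≤ b ×
    ((n Δ : ℕ) → Δ ≤ n → 100 * n < Δ * Δ →
      Σ ℕ λ T → Σ (Fin T → Vec ℕ n) λ p →
        ((i : Fin T) → IsPartitionLe n (p i)) ×
        ((i j : Fin T) → i ≢ j → Δ ≤ 100 * dist₁ (p i) (p j) × dist₁ (p i) (p j) ≤ Δ) ×
        Δ ^ (2 * a * n) ≤ T ^ (2 * b * Δ) * n ^ (a * n))
corollary1 = 1 , 12 , ≤-refl , s≤s z≤n , partition-packing
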